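{- Let $G$ be a finite, simple, connected unicyclic graph with unique cycle $C$, and let $S$ be a geodesic triple of vertices of $C$. Then any two vertices of $G$ that belong to two distinct connected components of $G-E(C)$ are distinguished by $S$, i.e. for such vertices $x,x'$ there is $s\in S$ with $d(x,s)\ne d(x',s)$.
   Context: A unicyclic graph is a connected graph containing exactly one cycle $C$; $d$ denotes the graph distance in $G$. Three distinct vertices $v_i,v_j,v_k$ of $C$ form a geodesic triple if $d(v_i,v_j)+d(v_j,v_k)+d(v_i,v_k)=|V(C)|$; the set of these three vertices is then called a geodesic triple. -}

module Defs where

open import Data.Nat using (ℕ; zero; suc; _+_; _≤_; NonZero)
open import Data.Nat.DivMod using (_%_; m%n<n)
open import Data.Fin using (Fin; toℕ; fromℕ<)
open import Data.Product using (Σ; ∃; _×_; _,_)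
open import Data.Sum using (_⊎_)
open import Data.Empty using (⊥)
open import Relation.Nullary using (¬_)
open import Relation.Binary.PropositionalEquality using (_≡_)
open import Function.Definitions using (Injective)

record Graph (n : ℕ) : Set₁ where
  field
    Adj     : Fin n → Fin n → Set
    sym     : ∀ {u v} → Adj u v → Adj v u
    irrefl  : ∀ {u} → ¬ Adj u u
open Graph public

data Walk {n : ℕ} (G : Graph n) : Fin n → Fin n → ℕ → Set where
  here : ∀ {u} → Walk G u u zero
  step : ∀ {u v w k} → Adj G u v → Walk G v w k → Walk G u w (suc k)

Reachable : ∀ {n} → Graph n → Fin n → Fin n → Set
Reachable G u v = ∃ λ k → Walk G u v k

Connected : ∀ {n} → Graph n → Set
Connected {n} G = (u v : Fin n) → Reachable G u v

Dist : ∀ {n} → Graph n → Fin n → Fin n → ℕ → Set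
Dist G u v k = Walk G u v k × (∀ m → Walk G u v m → k ≤ m)

next : ∀ {L} .{{_ : NonZero L}} → Fin L → Fin L
next {L} i = fromℕ< (m%n<n (suc (toℕ i)) L)

record Cycle {n : ℕ} (G : Graph n) : Set where
  field
    k    : ℕ
    vert : Fin (3 + k) → Fin n
    inj  : Injective _≡_ _≡_ vert
    adj  : ∀ i → Adj G (vert i) (vert (next i))
open Cycle public

len : ∀ {n} {G : Graph n} → Cycle G → ℕ
len C = 3 + k C

CycEdge : ∀ {n} {G : Graph n} → Cycle G → Fin n → Fin n → Set
CycEdge C u v = ∃ λ i → (u ≡ vert C i × v ≡ vert C (next i)) ⊎ (v ≡ vert C i × u ≡ vert C (next i))

-- two cycles are the same subgraph (same edge set; hence same vertex set)
SameCycle : ∀ {n} {G : Graph n} → Cycle G → Cycle G → Set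
SameCycle {n} C C' = ∀ (u v : Fin n) → (CycEdge C u v → CycEdge C' u v) × (CycEdge C' u v → CycEdge C u v)

Unicyclic : ∀ {n} (G : Graph n) → Cycle G → Set
Unicyclic G C = Connected G × (∀ (C' : Cycle G) → SameCycle C' C)

deleteCycleEdges : ∀ {n} (G : Graph n) → Cycle G → Graph n
deleteCycleEdges G C = record
  { Adj    = λ u v → Adj G u v × ¬ CycEdge C u v
  ; sym    = λ { (a , ne) → sym G a , λ e → ne (flipE e) }
  ; irrefl = λ { (a , _) → irrefl G a }
  }
  where
  flipE : ∀ {u v} → CycEdge C v u → CycEdge C u v
  flipE (i , Data.Sum.inj₁ (p , q)) = i , Data.Sum.inj₂ (p , q)
  flipE (i , Data.Sum.inj₂ (p , q)) = i , Data.Sum.inj₁ (p , q)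

GeodesicTriple : ∀ {n} (G : Graph n) (C : Cycle G) → Fin (len C) → Fin (len C) → Fin (len C) → Set
GeodesicTriple G C i j l =
  ¬ i ≡ j × ¬ j ≡ l × ¬ i ≡ l ×
  (∃ λ a → ∃ λ b → ∃ λ e →
     Dist G (vert C i) (vert C j) a × Dist G (vert C j) (vert C l) b ×
     Dist G (vert C i) (vert C l) e × a + b + e ≡ len C)

Distinguishes : ∀ {n} → Graph n → Fin n → Fin n → Fin n → Set
Distinguishes G s x x' = ¬ (∃ λ a → Dist G x s a × Dist G x' s a)

{-# OPTIONS --safe #-}
-- G − E(C) is a forest in which every vertex y hangs, at depth height y, below a unique cycle
-- vertex root y, and d(y, c s) = height y + δ (root y) s, with δ the distance along the cycle.
-- Vertices x, x′ in different components have different roots u ≠ v. If the geodesic triple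
-- {a, b, c} did not distinguish them, then h + δ u s ≡ h′ + δ v s for s = a, b, c, where h and
-- h′ are their heights. The three arcs between a, b and c are shortest and cover the cycle, so
-- u lies on a shortest arc between two of them, which forces h′ ≤ h; symmetrically h ≡ h′.
-- Then a, b and c are all equidistant from u and v along the cycle, whereas at most two
-- vertices of a cycle are.
module Submission where

open import Defs hiding (sym)
open import Data.Nat
open import Data.Nat.Properties
open import Data.Nat.DivMod
open import Data.Nat.GeneralisedArithmetic using (iterate)
open import Data.Nat.Tactic.RingSolver using (solve-∀)
open import Data.Fin as Fin using (Fin; toℕ)
open import Data.Fin.Properties using (toℕ-injective; toℕ<n; toℕ-fromℕ<; toℕ-fromℕ; any?)
open import Data.Product as Product using (Σ; ∃; _×_; _,_; proj₁; proj₂)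
open import Data.Sum as Sum using (_⊎_; inj₁; inj₂; map; [_,_]′)
open import Data.Unit using (⊤; tt)
open import Data.Empty using (⊥; ⊥-elim)
open import Function using (_∘_)
open import Function.Definitions using (Injective)
open import Relation.Nullary using (¬_; Dec; yes; no)
open import Relation.Nullary.Decidable using (_⊎-dec_; _×-dec_)
open import Relation.Binary.Core using (_⇒_)
open import Relation.Binary.Definitions using (tri<; tri≈; tri>)
open import Relation.Binary.PropositionalEquality

m<n+n⇒m≡m%n⊎m≡m%n+n : ∀ {m n} .{{_ : NonZero n}} → m < n + n → m ≡ m % n ⊎ m ≡ m % n + n
m<n+n⇒m≡m%n⊎m≡m%n+n {m} {n} m<n+n with m <? n
... | yes m<n = inj₁ (sym (m<n⇒m%n≡m m<n))
... | no m≮n = inj₂ (begin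
  m               ≡⟨ m∸n+n≡m n≤m ⟨
  m ∸ n + n       ≡⟨ cong (_+ n) (m<n⇒m%n≡m (m<n+o⇒m∸n<o m n m<n+n)) ⟨
  (m ∸ n) % n + n ≡⟨ cong (_+ n) (m≤n⇒[n∸m]%m≡n%m n≤m) ⟩
  m % n + n       ∎)
  where
  open ≡-Reasoning
  n≤m : n ≤ m
  n≤m = ≮⇒≥ m≮n

[m%n+o]%n≡[m+o]%n : ∀ m o n .{{_ : NonZero n}} → (m % n + o) % n ≡ (m + o) % n
[m%n+o]%n≡[m+o]%n m o n = begin
  (m % n + o) % n         ≡⟨ %-distribˡ-+ (m % n) o n ⟩
  (m % n % n + o % n) % n ≡⟨ cong (λ t → (t + o % n) % n) (m%n%n≡m%n m n) ⟩
  (m % n + o % n) % n     ≡⟨ %-distribˡ-+ m o n ⟨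
  (m + o) % n             ∎
  where open ≡-Reasoning

m+m≤n+n⇒m≤n : ∀ {m n} → m + m ≤ n + n → m ≤ n
m+m≤n+n⇒m≤n {m} {n} le with m ≤? n
... | yes m≤n = m≤n
... | no m≰n = ⊥-elim (<⇒≱ (+-mono-< (≰⇒> m≰n) (≰⇒> m≰n)) le)

m+m≡n+n⇒m≡n : ∀ {m n} → m + m ≡ n + n → m ≡ n
m+m≡n+n⇒m≡n e = ≤-antisym (m+m≤n+n⇒m≤n (≤-reflexive e)) (m+m≤n+n⇒m≤n (≤-reflexive (sym e)))

≤-sum⇒≥ : ∀ {x y z x′ y′ z′} → x ≤ x′ → y ≤ y′ → z ≤ z′ → x′ + y′ + z′ ≤ x + y + z → x′ ≤ x
≤-sum⇒≥ {x} {y} {z} {x′} {y′} {z′} x≤x′ y≤y′ z≤z′ le = +-cancelʳ-≤ (y + z) x′ x (begin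
  x′ + (y + z)   ≤⟨ +-monoʳ-≤ x′ (+-mono-≤ y≤y′ z≤z′) ⟩
  x′ + (y′ + z′) ≡⟨ +-assoc x′ y′ z′ ⟨
  x′ + y′ + z′   ≤⟨ le ⟩
  x + y + z      ≡⟨ +-assoc x y z ⟩
  x + (y + z)    ∎)
  where open ≤-Reasoning

+-rotate : ∀ x y z → x + y + z ≡ y + z + x
+-rotate = solve-∀

module CycleArithmetic (L : ℕ) .{{_ : NonZero L}} where

  -- cw a b: the number of steps from a to b in the direction of next.
  cw : Fin L → Fin L → ℕ
  cw a b = (toℕ b + (L ∸ toℕ a)) % L

  δ : Fin L → Fin L → ℕ
  δ a b = cw a b ⊓ cw b a

  cw<L : ∀ a b → cw a b < L
  cw<L a b = m%n<n (toℕ b + (L ∸ toℕ a)) L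

  toℕ+[L∸toℕ]≡L : ∀ (a : Fin L) → toℕ a + (L ∸ toℕ a) ≡ L
  toℕ+[L∸toℕ]≡L a = m+[n∸m]≡n (<⇒≤ (toℕ<n a))

  cw-refl : ∀ a → cw a a ≡ 0
  cw-refl a = trans (cong (_% L) (toℕ+[L∸toℕ]≡L a)) (n%n≡0 L)

  cw-+-mod : ∀ a b c → (cw a b + cw b c) % L ≡ cw a c
  cw-+-mod a b c = begin
    (x % L + y % L) % L          ≡⟨ %-distribˡ-+ x y L ⟨
    (x + y) % L                  ≡⟨ cong (_% L) x+y≡ ⟩
    (toℕ c + (L ∸ toℕ a) + L) % L ≡⟨ [m+n]%n≡m%n (toℕ c + (L ∸ toℕ a)) L ⟩
    cw a c                       ∎
    where
    open ≡-Reasoning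
    x = toℕ b + (L ∸ toℕ a)
    y = toℕ c + (L ∸ toℕ b)
    swap : ∀ p q r s → p + q + (r + s) ≡ r + q + (p + s)
    swap = solve-∀
    x+y≡ : x + y ≡ toℕ c + (L ∸ toℕ a) + L
    x+y≡ = trans (swap (toℕ b) (L ∸ toℕ a) (toℕ c) (L ∸ toℕ b))
                 (cong (toℕ c + (L ∸ toℕ a) +_) (toℕ+[L∸toℕ]≡L b))

  cw-split : ∀ a b c → cw a b + cw b c ≡ cw a c ⊎ cw a b + cw b c ≡ cw a c + L
  cw-split a b c rewrite sym (cw-+-mod a b c) =
    m<n+n⇒m≡m%n⊎m≡m%n+n (+-mono-< (cw<L a b) (cw<L b c))

  cw≡0⇒≡ : ∀ {a b} → cw a b ≡ 0 → a ≡ b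
  cw≡0⇒≡ {a} {b} cw≡0 with m<n+n⇒m≡m%n⊎m≡m%n+n (+-mono-<-≤ (toℕ<n b) (m∸n≤m L (toℕ a)))
  ... | inj₁ x≡0 = ⊥-elim (<⇒≢ (≤-trans (m<n⇒0<n∸m (toℕ<n a)) (m≤n+m (L ∸ toℕ a) (toℕ b)))
                              (sym (trans x≡0 cw≡0)))
  ... | inj₂ x≡L = sym (toℕ-injective (+-cancelʳ-≡ (L ∸ toℕ a) (toℕ b) (toℕ a)
                   (trans x≡L (trans (cong (_+ L) cw≡0) (sym (toℕ+[L∸toℕ]≡L a))))))

  cw-complement : ∀ {a b} → a ≢ b → cw a b + cw b a ≡ L
  cw-complement {a} {b} a≢b with cw-split a b a
  ... | inj₁ e = ⊥-elim (a≢b (cw≡0⇒≡ (m+n≡0⇒m≡0 (cw a b) (trans e (cw-refl a)))))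
  ... | inj₂ e = trans e (cong (_+ L) (cw-refl a))

  cw+cw≤L : ∀ a b → cw a b + cw b a ≤ L
  cw+cw≤L a b with a Fin.≟ b
  ... | yes refl = subst (_≤ L) (sym (cong₂ _+_ (cw-refl a) (cw-refl a))) z≤n
  ... | no a≢b = ≤-reflexive (cw-complement a≢b)

  cw-injectiveˡ : ∀ {a b} s → cw a s ≡ cw b s → a ≡ b
  cw-injectiveˡ {a} {b} s e with cw-split a b s
  ... | inj₁ e′ = cw≡0⇒≡ (+-cancelʳ-≡ (cw b s) (cw a b) 0 (trans e′ e))
  ... | inj₂ e′ = ⊥-elim (<⇒≢ (cw<L a b)
                    (+-cancelʳ-≡ (cw b s) (cw a b) L (trans e′ (trans (cong (_+ L) e) (+-comm (cw b s) L)))))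

  cw-injectiveʳ : ∀ {a b} s → cw s a ≡ cw s b → a ≡ b
  cw-injectiveʳ {a} {b} s e with cw-split s a b
  ... | inj₁ e′ = cw≡0⇒≡ (+-cancelˡ-≡ (cw s a) (cw a b) 0 (trans e′ (trans (sym e) (sym (+-identityʳ _)))))
  ... | inj₂ e′ = ⊥-elim (<⇒≢ (cw<L a b) (+-cancelˡ-≡ (cw s a) (cw a b) L (trans e′ (cong (_+ L) (sym e)))))

  cw-triangle : ∀ a b c → cw a c ≤ cw a b + cw b c
  cw-triangle a b c with cw-split a b c
  ... | inj₁ e = ≤-reflexive (sym e)
  ... | inj₂ e = ≤-trans (m≤m+n (cw a c) L) (≤-reflexive (sym e))

  -- Walking from a to c and then t steps further passes a again.
  cw-wrap : ∀ a c {t u} → cw a c + t ≡ u + L → cw c a ≤ t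
  cw-wrap a c {t} {u} e = +-cancelʳ-≤ (cw a c) (cw c a) t (begin
    cw c a + cw a c ≤⟨ cw+cw≤L c a ⟩
    L               ≤⟨ m≤n+m L u ⟩
    u + L           ≡⟨ e ⟨
    cw a c + t      ≡⟨ +-comm (cw a c) t ⟩
    t + cw a c      ∎)
    where open ≤-Reasoning

  δ-comm : ∀ a b → δ a b ≡ δ b a
  δ-comm a b = ⊓-comm (cw a b) (cw b a)

  δ≤cw : ∀ a b → δ a b ≤ cw a b
  δ≤cw a b = m⊓n≤m (cw a b) (cw b a)

  δ≤cw⁻ : ∀ a b → δ a b ≤ cw b a
  δ≤cw⁻ a b = m⊓n≤n (cw a b) (cw b a)

  δ-sel : ∀ a b → δ a b ≡ cw a b ⊎ δ a b ≡ cw b a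
  δ-sel a b = ⊓-sel (cw a b) (cw b a)

  δ-refl : ∀ a → δ a a ≡ 0
  δ-refl a = n≤0⇒n≡0 (subst (δ a a ≤_) (cw-refl a) (δ≤cw a a))

  δ-converging : ∀ a b c → δ a c ≤ cw a b + cw c b
  δ-converging a b c with cw-split a c b
  ... | inj₁ e = ≤-trans (δ≤cw a c) (≤-trans (m+n≤o⇒m≤o (cw a c) (≤-reflexive e)) (m≤m+n (cw a b) (cw c b)))
  ... | inj₂ e = ≤-trans (δ≤cw⁻ a c) (≤-trans (cw-wrap a c e) (m≤n+m (cw c b) (cw a b)))

  δ-diverging : ∀ a b c → δ a c ≤ cw b a + cw b c
  δ-diverging a b c with cw-split b a c
  ... | inj₁ e = ≤-trans (δ≤cw a c) (≤-trans (m+n≤o⇒n≤o (cw b a) (≤-reflexive e)) (m≤n+m (cw b c) (cw b a)))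
  ... | inj₂ e = ≤-trans (δ≤cw⁻ a c)
                   (≤-trans (cw-wrap a c (trans (+-comm (cw a c) (cw b a)) e)) (m≤m+n (cw b a) (cw b c)))

  δ-triangle : ∀ a b c → δ a c ≤ δ a b + δ b c
  δ-triangle a b c with δ-sel a b | δ-sel b c
  ... | inj₁ ab | inj₁ bc rewrite ab | bc = ≤-trans (δ≤cw a c) (cw-triangle a b c)
  ... | inj₂ ab | inj₂ bc rewrite ab | bc =
    ≤-trans (δ≤cw⁻ a c) (≤-trans (cw-triangle c b a) (≤-reflexive (+-comm (cw c b) (cw b a))))
  ... | inj₁ ab | inj₂ bc rewrite ab | bc = δ-converging a b c
  ... | inj₂ ab | inj₁ bc rewrite ab | bc = δ-diverging a b c

  toℕ-next : ∀ a → toℕ (next a) ≡ suc (toℕ a) % L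
  toℕ-next a = toℕ-fromℕ< (m%n<n (suc (toℕ a)) L)

  toℕ-next-< : ∀ a → suc (toℕ a) < L → toℕ (next a) ≡ suc (toℕ a)
  toℕ-next-< a lt = trans (toℕ-next a) (m<n⇒m%n≡m lt)

  toℕ-next-last : ∀ a → suc (toℕ a) ≡ L → toℕ (next a) ≡ 0
  toℕ-next-last a e = trans (toℕ-next a) (trans (cong (_% L) e) (n%n≡0 L))

  toℕ-iterate-next : ∀ t a → toℕ (iterate next a t) ≡ (toℕ a + t) % L
  toℕ-iterate-next zero a = sym (trans (cong (_% L) (+-identityʳ (toℕ a))) (m<n⇒m%n≡m (toℕ<n a)))
  toℕ-iterate-next (suc t) a = begin
    toℕ (iterate next (next a) t) ≡⟨ toℕ-iterate-next t (next a) ⟩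
    (toℕ (next a) + t) % L        ≡⟨ cong (λ x → (x + t) % L) (toℕ-next a) ⟩
    (suc (toℕ a) % L + t) % L     ≡⟨ [m%n+o]%n≡[m+o]%n (suc (toℕ a)) t L ⟩
    (suc (toℕ a) + t) % L         ≡⟨ cong (_% L) (+-suc (toℕ a) t) ⟨
    (toℕ a + suc t) % L           ∎
    where open ≡-Reasoning

  iterate-next-cw : ∀ a b → iterate next a (cw a b) ≡ b
  iterate-next-cw a b = toℕ-injective (begin
    toℕ (iterate next a (cw a b))      ≡⟨ toℕ-iterate-next (cw a b) a ⟩
    (toℕ a + x % L) % L                ≡⟨ cong (_% L) (+-comm (toℕ a) (x % L)) ⟩
    (x % L + toℕ a) % L                ≡⟨ [m%n+o]%n≡[m+o]%n x (toℕ a) L ⟩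
    (toℕ b + (L ∸ toℕ a) + toℕ a) % L   ≡⟨ cong (_% L) (+-assoc (toℕ b) (L ∸ toℕ a) (toℕ a)) ⟩
    (toℕ b + (L ∸ toℕ a + toℕ a)) % L   ≡⟨ cong (λ t → (toℕ b + t) % L) (m∸n+n≡m (<⇒≤ (toℕ<n a))) ⟩
    (toℕ b + L) % L                    ≡⟨ [m+n]%n≡m%n (toℕ b) L ⟩
    toℕ b % L                          ≡⟨ m<n⇒m%n≡m (toℕ<n b) ⟩
    toℕ b                              ∎)
    where
    open ≡-Reasoning
    x = toℕ b + (L ∸ toℕ a)

  cw-next : 1 < L → ∀ a → cw a (next a) ≡ 1
  cw-next 1<L a = begin
    (toℕ (next a) + (L ∸ toℕ a)) % L   ≡⟨ cong (λ t → (t + (L ∸ toℕ a)) % L) (toℕ-next a) ⟩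
    (suc (toℕ a) % L + (L ∸ toℕ a)) % L ≡⟨ [m%n+o]%n≡[m+o]%n (suc (toℕ a)) (L ∸ toℕ a) L ⟩
    suc (toℕ a + (L ∸ toℕ a)) % L      ≡⟨ cong (λ t → suc t % L) (toℕ+[L∸toℕ]≡L a) ⟩
    (1 + L) % L                        ≡⟨ [m+n]%n≡m%n 1 L ⟩
    1 % L                              ≡⟨ m<n⇒m%n≡m 1<L ⟩
    1                                  ∎
    where open ≡-Reasoning

  δ-next≤1 : 1 < L → ∀ a → δ a (next a) ≤ 1
  δ-next≤1 1<L a = ≤-trans (δ≤cw a (next a)) (≤-reflexive (cw-next 1<L a))

  δ≤1+δ-next : 1 < L → ∀ a s → δ a s ≤ suc (δ (next a) s)
  δ≤1+δ-next 1<L a s = ≤-trans (δ-triangle a (next a) s) (+-monoˡ-≤ (δ (next a) s) (δ-next≤1 1<L a))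

  δ-next≤1+δ : 1 < L → ∀ a s → δ (next a) s ≤ suc (δ a s)
  δ-next≤1+δ 1<L a s = ≤-trans (δ-triangle (next a) a s)
    (+-monoˡ-≤ (δ a s) (subst (_≤ 1) (δ-comm a (next a)) (δ-next≤1 1<L a)))

  Between : Fin L → Fin L → Fin L → Set
  Between a b w = δ w a + δ w b ≤ δ a b

  Between-sym : ∀ a b {w} → Between a b w → Between b a w
  Between-sym a b {w} le = subst₂ _≤_ (+-comm (δ w a) (δ w b)) (δ-comm a b) le

  on-some-arc : ∀ {a b c} → cw a b + cw b c + cw c a ≡ L → ∀ w →
                cw a w + cw w b ≡ cw a b ⊎ cw b w + cw w c ≡ cw b c ⊎ cw c w + cw w a ≡ cw c a
  on-some-arc {a} {b} {c} orient w with cw-split a w b | cw-split b w c | cw-split c w a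
  ... | inj₁ e  | _      | _      = inj₁ e
  ... | inj₂ _  | inj₁ e | _      = inj₂ (inj₁ e)
  ... | inj₂ _  | inj₂ _ | inj₁ e = inj₂ (inj₂ e)
  ... | inj₂ ab | inj₂ bc | inj₂ ca = ⊥-elim (<-irrefl refl (begin-strict
    L + L + L                                                  <⟨ m<n+m (L + L + L) (>-nonZero⁻¹ L) ⟩
    L + (L + L + L)                                            ≡⟨ cong (_+ (L + L + L)) orient ⟨
    cw a b + cw b c + cw c a + (L + L + L)                     ≡⟨ spread (cw a b) (cw b c) (cw c a) L ⟩
    (cw a b + L) + (cw b c + L) + (cw c a + L)                 ≡⟨ cong₂ _+_ (cong₂ _+_ ab bc) ca ⟨
    (cw a w + cw w b) + (cw b w + cw w c) + (cw c w + cw w a)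
      ≡⟨ regroup (cw a w) (cw w b) (cw b w) (cw w c) (cw c w) (cw w a) ⟩
    (cw a w + cw w a) + (cw b w + cw w b) + (cw c w + cw w c)
      ≤⟨ +-mono-≤ (+-mono-≤ (cw+cw≤L a w) (cw+cw≤L b w)) (cw+cw≤L c w) ⟩
    L + L + L                                                  ∎))
    where
    open ≤-Reasoning
    spread : ∀ p q r l → p + q + r + (l + l + l) ≡ (p + l) + (q + l) + (r + l)
    spread = solve-∀
    regroup : ∀ p p′ q q′ r r′ → (p + p′) + (q + q′) + (r + r′) ≡ (p + r′) + (q + p′) + (r + q′)
    regroup = solve-∀

  Geodesic : Fin L → Fin L → Fin L → Set
  Geodesic a b c = δ a b + δ b c + δ a c ≡ L

  Geodesic-swap : ∀ {a b c} → Geodesic a b c → Geodesic a c b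
  Geodesic-swap {a} {b} {c} geodesic =
    trans (cong (λ t → δ a c + t + δ a b) (δ-comm c b)) (trans (reverse (δ a c) (δ b c) (δ a b)) geodesic)
    where
    reverse : ∀ p q r → p + q + r ≡ r + q + p
    reverse = solve-∀

  oriented-cover : ∀ {a b c} → cw a b + cw b c + cw c a ≡ L → Geodesic a b c → ∀ w →
                   Between a b w ⊎ Between b c w ⊎ Between a c w
  oriented-cover {a} {b} {c} orient geodesic w =
    map (on-arc a b cw≤δ-ab) (map (on-arc b c cw≤δ-bc) (Between-sym c a ∘ on-arc c a cw≤δ-ca)) (on-some-arc orient w)
    where
    cw-sum≤δ-sum : cw a b + cw b c + cw c a ≤ δ a b + δ b c + δ a c
    cw-sum≤δ-sum = ≤-reflexive (trans orient (sym geodesic))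
    cw≤δ-ab : cw a b ≤ δ a b
    cw≤δ-ab = ≤-sum⇒≥ (δ≤cw a b) (δ≤cw b c) (δ≤cw⁻ a c) cw-sum≤δ-sum
    cw≤δ-bc : cw b c ≤ δ b c
    cw≤δ-bc = ≤-sum⇒≥ (δ≤cw b c) (δ≤cw⁻ a c) (δ≤cw a b)
      (subst₂ _≤_ (+-rotate (cw a b) _ _) (+-rotate (δ a b) _ _) cw-sum≤δ-sum)
    cw≤δ-ca : cw c a ≤ δ c a
    cw≤δ-ca = subst (cw c a ≤_) (δ-comm a c) (≤-sum⇒≥ (δ≤cw⁻ a c) (δ≤cw a b) (δ≤cw b c)
      (subst₂ _≤_ (sym (+-rotate (cw c a) _ _)) (sym (+-rotate (δ a c) _ _)) cw-sum≤δ-sum))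
    on-arc : ∀ x y → cw x y ≤ δ x y → cw x w + cw w y ≡ cw x y → Between x y w
    on-arc x y cw≤δ e = ≤-trans (+-mono-≤ (δ≤cw⁻ w x) (δ≤cw w y)) (≤-trans (≤-reflexive e) cw≤δ)

  orientation : ∀ {a b c} → a ≢ b → b ≢ c → a ≢ c →
                cw a b + cw b c + cw c a ≡ L ⊎ cw a c + cw c b + cw b a ≡ L
  orientation {a} {b} {c} a≢b b≢c a≢c with cw-split a b c
  ... | inj₁ e = inj₁ (trans (cong (_+ cw c a) e) (cw-complement a≢c))
  ... | inj₂ e = inj₂ (+-cancelʳ-≡ (cw a b + cw b c) _ _ (begin
    cw a c + cw c b + cw b a + (cw a b + cw b c)   ≡⟨ regroup (cw a c) (cw c b) (cw b a) (cw a b) (cw b c) ⟩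
    cw a c + (cw b c + cw c b) + (cw a b + cw b a)
      ≡⟨ cong₂ (λ p q → cw a c + p + q) (cw-complement b≢c) (cw-complement a≢b) ⟩
    cw a c + L + L                                 ≡⟨ cong (_+ L) e ⟨
    cw a b + cw b c + L                            ≡⟨ +-comm (cw a b + cw b c) L ⟩
    L + (cw a b + cw b c)                          ∎))
    where
    open ≡-Reasoning
    regroup : ∀ p q r s t → p + q + r + (s + t) ≡ p + (t + q) + (s + r)
    regroup = solve-∀

  geodesic-cover : ∀ {a b c} → a ≢ b → b ≢ c → a ≢ c → Geodesic a b c → ∀ w →
                   Between a b w ⊎ Between b c w ⊎ Between a c w
  geodesic-cover {a} {b} {c} a≢b b≢c a≢c geodesic w with orientation a≢b b≢c a≢c
  ... | inj₁ orient = oriented-cover orient geodesic w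
  ... | inj₂ orient with oriented-cover orient (Geodesic-swap {a} {b} {c} geodesic) w
  ...   | inj₁ ac        = inj₂ (inj₂ ac)
  ...   | inj₂ (inj₁ cb) = inj₂ (inj₁ (Between-sym c b cb))
  ...   | inj₂ (inj₂ ab) = inj₁ ab

  height-≤ : ∀ a b u v {h h′} → Between a b u → h + δ u a ≡ h′ + δ v a → h + δ u b ≡ h′ + δ v b → h′ ≤ h
  height-≤ a b u v {h} {h′} between ea eb = m+m≤n+n⇒m≤n (+-cancelʳ-≤ (δ a b) (h′ + h′) (h + h) (begin
    h′ + h′ + δ a b                 ≤⟨ +-monoʳ-≤ (h′ + h′) (subst (δ a b ≤_) (cong (_+ δ v b) (δ-comm a v)) triangle) ⟩
    h′ + h′ + (δ v a + δ v b)       ≡⟨ interleave h′ (δ v a) (δ v b) ⟨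
    (h′ + δ v a) + (h′ + δ v b)     ≡⟨ cong₂ _+_ ea eb ⟨
    (h + δ u a) + (h + δ u b)       ≡⟨ interleave h (δ u a) (δ u b) ⟩
    h + h + (δ u a + δ u b)         ≤⟨ +-monoʳ-≤ (h + h) between ⟩
    h + h + δ a b                   ∎))
    where
    open ≤-Reasoning
    triangle : δ a b ≤ δ a v + δ v b
    triangle = δ-triangle a v b
    interleave : ∀ x p q → (x + p) + (x + q) ≡ x + x + (p + q)
    interleave = solve-∀

  -- s is the midpoint of one of the two arcs between u and v.
  equidistant : ∀ {u v} s → u ≢ v → δ u s ≡ δ v s →
                cw u s + cw u s ≡ cw u v ⊎ cw u s + cw u s ≡ cw u v + L
  equidistant {u} {v} s u≢v e with δ-sel u s | δ-sel v s
  ... | inj₁ us | inj₁ vs = ⊥-elim (u≢v (cw-injectiveˡ s (trans (sym us) (trans e vs))))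
  ... | inj₂ us | inj₂ vs = ⊥-elim (u≢v (cw-injectiveʳ s (trans (sym us) (trans e vs))))
  ... | inj₁ us | inj₂ vs =
    subst (λ t → cw u s + t ≡ cw u v ⊎ cw u s + t ≡ cw u v + L) (trans (sym vs) (trans (sym e) us)) (cw-split u s v)
  ... | inj₂ us | inj₁ vs with u Fin.≟ s
  ...   | yes refl = ⊥-elim (u≢v (sym (cw≡0⇒≡ (trans (sym vs) (trans (sym e) (trans us (cw-refl u)))))))
  ...   | no u≢s = [ inj₂ ∘ beyond , inj₁ ∘ wrapped ]′
                   (subst (λ t → cw u v + t ≡ cw u s ⊎ cw u v + t ≡ cw u s + L) (trans (sym vs) (trans (sym e) us))
                          (cw-split u v s))
    where
    open ≡-Reasoning
    twice+back : cw u s + cw u s + cw s u ≡ cw u s + L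
    twice+back = trans (+-assoc (cw u s) _ _) (cong (cw u s +_) (cw-complement u≢s))
    beyond : cw u v + cw s u ≡ cw u s → cw u s + cw u s ≡ cw u v + L
    beyond e′ = +-cancelʳ-≡ (cw s u) _ _ (begin
      cw u s + cw u s + cw s u ≡⟨ twice+back ⟩
      cw u s + L               ≡⟨ cong (_+ L) e′ ⟨
      cw u v + cw s u + L      ≡⟨ exchange (cw u v) (cw s u) L ⟩
      cw u v + L + cw s u      ∎)
      where
      exchange : ∀ p q r → p + q + r ≡ p + r + q
      exchange = solve-∀
    wrapped : cw u v + cw s u ≡ cw u s + L → cw u s + cw u s ≡ cw u v
    wrapped e′ = +-cancelʳ-≡ (cw s u) _ _ (trans twice+back (sym e′))

  cw-twice-injective : ∀ u {p q t} → cw u p + cw u p ≡ t → cw u q + cw u q ≡ t → p ≡ q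
  cw-twice-injective u ep eq = cw-injectiveʳ u (m+m≡n+n⇒m≡n (trans ep (sym eq)))

  at-most-two-equidistant : ∀ {u v a b c} → u ≢ v → δ u a ≡ δ v a → δ u b ≡ δ v b → δ u c ≡ δ v c →
                            a ≡ b ⊎ b ≡ c ⊎ a ≡ c
  at-most-two-equidistant {u} {v} {a} {b} {c} u≢v ea eb ec
    with equidistant a u≢v ea | equidistant b u≢v eb | equidistant c u≢v ec
  ... | inj₁ x | inj₁ y | _      = inj₁ (cw-twice-injective u x y)
  ... | inj₂ x | inj₂ y | _      = inj₁ (cw-twice-injective u x y)
  ... | inj₁ _ | inj₂ y | inj₂ z = inj₂ (inj₁ (cw-twice-injective u y z))
  ... | inj₂ _ | inj₁ y | inj₁ z = inj₂ (inj₁ (cw-twice-injective u y z))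
  ... | inj₁ x | inj₂ _ | inj₁ z = inj₂ (inj₂ (cw-twice-injective u x z))
  ... | inj₂ x | inj₁ _ | inj₂ z = inj₂ (inj₂ (cw-twice-injective u x z))

  module _ {a b c} (a≢b : a ≢ b) (b≢c : b ≢ c) (a≢c : a ≢ c) (geodesic : Geodesic a b c) where

    geodesic-heights-≤ : ∀ u v {h h′} →
                         h + δ u a ≡ h′ + δ v a → h + δ u b ≡ h′ + δ v b → h + δ u c ≡ h′ + δ v c → h′ ≤ h
    geodesic-heights-≤ u v ea eb ec with geodesic-cover a≢b b≢c a≢c geodesic u
    ... | inj₁ ab = height-≤ a b u v ab ea eb
    ... | inj₂ (inj₁ bc) = height-≤ b c u v bc eb ec
    ... | inj₂ (inj₂ ac) = height-≤ a c u v ac ea ec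

    geodesic-heights : ∀ u v {h h′} →
                       h + δ u a ≡ h′ + δ v a → h + δ u b ≡ h′ + δ v b → h + δ u c ≡ h′ + δ v c → h ≡ h′
    geodesic-heights u v ea eb ec =
      ≤-antisym (geodesic-heights-≤ v u (sym ea) (sym eb) (sym ec)) (geodesic-heights-≤ u v ea eb ec)

    geodesic-resolves : ∀ {u v h h′} → u ≢ v →
                        h + δ u a ≡ h′ + δ v a → h + δ u b ≡ h′ + δ v b → h + δ u c ≡ h′ + δ v c → ⊥
    geodesic-resolves {u} {v} {h} {h′} u≢v ea eb ec =
      [ a≢b , [ b≢c , a≢c ]′ ]′ (at-most-two-equidistant u≢v (drop ea) (drop eb) (drop ec))
      where
      drop : ∀ {s} → h + δ u s ≡ h′ + δ v s → δ u s ≡ δ v s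
      drop e = +-cancelˡ-≡ h _ _ (trans e (cong (_+ _) (sym (geodesic-heights u v ea eb ec))))

module _ {n : ℕ} where

  _++_ : ∀ {G : Graph n} {u v w m m′} → Walk G u v m → Walk G v w m′ → Walk G u w (m + m′)
  here     ++ q = q
  step a p ++ q = step a (p ++ q)

  reverse : ∀ {G : Graph n} {u v m} → Walk G u v m → Walk G v u m
  reverse here = here
  reverse {G} (step {k = m} a p) = subst (Walk G _ _) (+-comm m 1) (reverse p ++ step (Graph.sym G a) here)

  map-walk : ∀ {G H : Graph n} → Adj G ⇒ Adj H → ∀ {u v m} → Walk G u v m → Walk H u v m
  map-walk f here       = here
  map-walk f (step a p) = step (f a) (map-walk f p)

  _∈ᵥ_ : ∀ {G : Graph n} {u v m} → Fin n → Walk G u v m → Set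
  x ∈ᵥ here {u = u}     = x ≡ u
  x ∈ᵥ step {u = u} _ p = x ≡ u ⊎ x ∈ᵥ p

  _∈ᵥ?_ : ∀ {G : Graph n} {u v m} (x : Fin n) (p : Walk G u v m) → Dec (x ∈ᵥ p)
  x ∈ᵥ? here {u = u}     = x Fin.≟ u
  x ∈ᵥ? step {u = u} _ p = (x Fin.≟ u) ⊎-dec (x ∈ᵥ? p)

  start-∈ᵥ : ∀ {G : Graph n} {u v m} (p : Walk G u v m) → u ∈ᵥ p
  start-∈ᵥ here       = refl
  start-∈ᵥ (step _ p) = inj₁ refl

  end-∈ᵥ : ∀ {G : Graph n} {u v m} (p : Walk G u v m) → v ∈ᵥ p
  end-∈ᵥ here       = refl
  end-∈ᵥ (step _ p) = inj₂ (end-∈ᵥ p)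

  IsPath : ∀ {G : Graph n} {u v m} → Walk G u v m → Set
  IsPath here              = ⊤
  IsPath (step {u = u} _ p) = ¬ u ∈ᵥ p × IsPath p

  record Path (G : Graph n) (u v : Fin n) : Set where
    constructor path
    field
      {length} : ℕ
      walk     : Walk G u v length
      isPath   : IsPath walk

  open Path public

  suffix : ∀ {G : Graph n} {x u v m} (p : Walk G u v m) → IsPath p → x ∈ᵥ p → Σ (Path G x v) λ q → length q ≤ m
  suffix here       p-path       refl       = path here tt , z≤n
  suffix (step a p) p-path       (inj₁ refl) = path (step a p) p-path , ≤-refl
  suffix (step a p) (_ , p-path) (inj₂ x∈p) = Product.map₂ m≤n⇒m≤1+n (suffix p p-path x∈p)

  pathify : ∀ {G : Graph n} {u v m} → Walk G u v m → Σ (Path G u v) λ q → length q ≤ m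
  pathify here = path here tt , z≤n
  pathify (step {u = u} a p) with pathify p
  ... | path q q-path , q≤p with u ∈ᵥ? q
  ...   | yes u∈q = Product.map₂ (λ le → m≤n⇒m≤1+n (≤-trans le q≤p)) (suffix q q-path u∈q)
  ...   | no u∉q  = path (step a q) (u∉q , q-path) , s≤s q≤p

  path-loop-length : ∀ {G : Graph n} {u v m} (p : Walk G u v m) → IsPath p → u ≡ v → m ≡ 0
  path-loop-length here       _         _    = refl
  path-loop-length (step _ p) (u∉p , _) refl = ⊥-elim (u∉p (end-∈ᵥ p))

  map-walk-avoiding : ∀ {G H : Graph n} x → (∀ {s t} → Adj G s t → s ≢ x → t ≢ x → Adj H s t) →
                      ∀ {u v m} (p : Walk G u v m) → ¬ x ∈ᵥ p → Walk H u v m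
  map-walk-avoiding x f here       x∉p = here
  map-walk-avoiding x f (step a p) x∉p =
    step (f a (λ u≡x → x∉p (inj₁ (sym u≡x))) (λ w≡x → x∉p (inj₂ (subst (_∈ᵥ p) w≡x (start-∈ᵥ p)))))
         (map-walk-avoiding x f p (λ x∈p → x∉p (inj₂ x∈p)))

  vertexAt : ∀ {G : Graph n} {u v m} → Walk G u v m → ℕ → Fin n
  vertexAt (here {u = u})     _       = u
  vertexAt (step {u = u} _ p) zero    = u
  vertexAt (step _ p)         (suc t) = vertexAt p t

  vertexAt-start : ∀ {G : Graph n} {u v m} (p : Walk G u v m) → vertexAt p 0 ≡ u
  vertexAt-start here       = refl
  vertexAt-start (step _ p) = refl

  vertexAt-end : ∀ {G : Graph n} {u v m} (p : Walk G u v m) → vertexAt p m ≡ v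
  vertexAt-end here       = refl
  vertexAt-end (step _ p) = vertexAt-end p

  vertexAt-adj : ∀ {G : Graph n} {u v m} (p : Walk G u v m) t → t < m → Adj G (vertexAt p t) (vertexAt p (suc t))
  vertexAt-adj (step a here)       zero    _         = a
  vertexAt-adj (step a (step _ _)) zero    _         = a
  vertexAt-adj (step _ p)          (suc t) (s≤s t<m) = vertexAt-adj p t t<m

  vertexAt-∈ᵥ : ∀ {G : Graph n} {u v m} (p : Walk G u v m) t → t ≤ m → vertexAt p t ∈ᵥ p
  vertexAt-∈ᵥ here       t       _         = refl
  vertexAt-∈ᵥ (step _ p) zero    _         = inj₁ refl
  vertexAt-∈ᵥ (step _ p) (suc t) (s≤s t≤m) = inj₂ (vertexAt-∈ᵥ p t t≤m)

  path-vertexAt-distinct : ∀ {G : Graph n} {u v m} (p : Walk G u v m) → IsPath p →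
                           ∀ {t t′} → t < t′ → t′ ≤ m → vertexAt p t ≢ vertexAt p t′
  path-vertexAt-distinct (step _ p) (u∉p , _) {zero} {suc t′} _ (s≤s t′≤m) e =
    u∉p (subst (_∈ᵥ p) (sym e) (vertexAt-∈ᵥ p t′ t′≤m))
  path-vertexAt-distinct (step _ p) (_ , p-path) {suc t} {suc t′} (s≤s t<t′) (s≤s t′≤m) =
    path-vertexAt-distinct p p-path t<t′ t′≤m

  path-vertexAt-injective : ∀ {G : Graph n} {u v m} (p : Walk G u v m) → IsPath p →
                            ∀ {t t′} → t ≤ m → t′ ≤ m → vertexAt p t ≡ vertexAt p t′ → t ≡ t′
  path-vertexAt-injective p p-path {t} {t′} t≤m t′≤m e with <-cmp t t′
  ... | tri≈ _ t≡t′ _ = t≡t′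
  ... | tri< t<t′ _ _ = ⊥-elim (path-vertexAt-distinct p p-path t<t′ t′≤m e)
  ... | tri> _ _ t′<t = ⊥-elim (path-vertexAt-distinct p p-path t′<t t≤m (sym e))

  subgraph : (G : Graph n) (P : Fin n → Fin n → Set) → (∀ {u v} → P u v → P v u) → Graph n
  subgraph G P P-sym = record
    { Adj    = λ u v → Adj G u v × P u v
    ; sym    = λ (a , p) → Graph.sym G a , P-sym p
    ; irrefl = λ (a , _) → irrefl G a
    }

  deleteEdge : Graph n → Fin n → Fin n → Graph n
  deleteEdge G a b = subgraph G (λ u v → ¬ (u ≡ a × v ≡ b) × ¬ (u ≡ b × v ≡ a))
                                (λ (≢ab , ≢ba) → (λ e → ≢ba (Product.swap e)) , (λ e → ≢ab (Product.swap e)))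

  cycle-from-path : ∀ {G H : Graph n} → Adj H ⇒ Adj G → ∀ {a b k} (p : Walk H b a (2 + k)) → IsPath p →
                    Adj G a b → Σ (Cycle G) λ C → CycEdge C a b
  cycle-from-path {G} H⊆G {a} {b} {k} p p-path a-b = C , last , inj₁ (sym vertex-last , sym vertex-next-last)
    where
    open CycleArithmetic (3 + k) using (toℕ-next-<; toℕ-next-last)
    vertex : Fin (3 + k) → Fin n
    vertex i = vertexAt p (toℕ i)
    in-range : ∀ (i : Fin (3 + k)) → toℕ i ≤ 2 + k
    in-range i = s≤s⁻¹ (toℕ<n i)
    vertex-injective : Injective _≡_ _≡_ vertex
    vertex-injective e = toℕ-injective (path-vertexAt-injective p p-path (in-range _) (in-range _) e)
    vertex-adj : ∀ i → Adj G (vertex i) (vertex (next i))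
    vertex-adj i with toℕ i <? 2 + k
    ... | yes i<last = subst (λ t → Adj G (vertex i) (vertexAt p t)) (sym (toℕ-next-< i (s≤s i<last)))
                             (H⊆G (vertexAt-adj p (toℕ i) i<last))
    ... | no i≮last = subst₂ (Adj G) (sym (trans (cong (vertexAt p) i≡last) (vertexAt-end p)))
                             (sym (trans (cong (vertexAt p) (toℕ-next-last i (cong suc i≡last))) (vertexAt-start p))) a-b
      where
      i≡last : toℕ i ≡ 2 + k
      i≡last = ≤-antisym (in-range i) (≮⇒≥ i≮last)
    C : Cycle G
    C = record { k = k ; vert = vertex ; inj = vertex-injective ; adj = vertex-adj }
    last : Fin (3 + k)
    last = Fin.fromℕ (2 + k)
    vertex-last : vertex last ≡ a
    vertex-last = trans (cong (vertexAt p) (toℕ-fromℕ (2 + k))) (vertexAt-end p)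
    vertex-next-last : vertex (next last) ≡ b
    vertex-next-last = trans (cong (vertexAt p) (toℕ-next-last last (cong suc (toℕ-fromℕ (2 + k))))) (vertexAt-start p)

Dist-unique : ∀ {n} {G : Graph n} {u v a b} → Dist G u v a → Dist G u v b → a ≡ b
Dist-unique (walk-a , shortest-a) (walk-b , shortest-b) = ≤-antisym (shortest-a _ walk-b) (shortest-b _ walk-a)

CycEdge-sym : ∀ {n} {G : Graph n} (C : Cycle G) {u v} → CycEdge C u v → CycEdge C v u
CycEdge-sym C (i , e) = i , Sum.swap e

module UnicyclicGraph {n : ℕ} (G : Graph n) (C : Cycle G) (unicyclic : Unicyclic G C) where

  open CycleArithmetic (len C) public

  c : Fin (len C) → Fin n
  c = vert C

  Forest : Graph n
  Forest = deleteCycleEdges G C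

  CycleGraph : Graph n
  CycleGraph = subgraph G (CycEdge C) (CycEdge-sym C)

  1<len : 1 < len C
  1<len = s≤s (s≤s z≤n)

  off-cycle-edge-is-bridge : ∀ {a b m} → Adj G a b → ¬ CycEdge C a b → ¬ Walk (deleteEdge G a b) b a m
  off-cycle-edge-is-bridge {a} {b} a-b a-b∉C w with pathify w
  ... | path here _ , _ = irrefl G a-b
  ... | path (step e here) _ , _ = proj₂ (proj₂ e) (refl , refl)
  ... | path (step e (step e′ q)) p-path , _ =
    let C′ , a-b∈C′ = cycle-from-path proj₁ (step e (step e′ q)) p-path a-b
    in a-b∉C (proj₁ (proj₂ unicyclic C′ a b) a-b∈C′)

  CycleGraph⊆deleteEdge : ∀ {a b} → ¬ CycEdge C a b → Adj CycleGraph ⇒ Adj (deleteEdge G a b)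
  CycleGraph⊆deleteEdge a-b∉C (s-t , s-t∈C) =
    s-t , (λ (s≡a , t≡b) → a-b∉C (subst₂ (CycEdge C) s≡a t≡b s-t∈C))
        , (λ (s≡b , t≡a) → a-b∉C (CycEdge-sym C (subst₂ (CycEdge C) s≡b t≡a s-t∈C)))

  forest-edge-avoiding : ∀ {x y s t} → Adj Forest s t → s ≢ x → t ≢ x → Adj (deleteEdge G x y) s t
  forest-edge-avoiding s-t s≢x t≢x = proj₁ s-t , (λ (s≡x , _) → s≢x s≡x) , (λ (_ , t≡x) → t≢x t≡x)

  cycle-step : ∀ a → Adj CycleGraph (c a) (c (next a))
  cycle-step a = adj C a , a , inj₁ (refl , refl)

  forward : ∀ t a → Walk CycleGraph (c a) (c (iterate next a t)) t
  forward zero    a = here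
  forward (suc t) a = step (cycle-step a) (forward t (next a))

  forward-arc : ∀ a b → Walk CycleGraph (c a) (c b) (cw a b)
  forward-arc a b = subst (λ z → Walk CycleGraph (c a) (c z) (cw a b)) (iterate-next-cw a b) (forward (cw a b) a)

  arc : ∀ a b → Walk CycleGraph (c a) (c b) (δ a b)
  arc a b with δ-sel a b
  ... | inj₁ e rewrite e = forward-arc a b
  ... | inj₂ e rewrite e = reverse (forward-arc b a)

  -- The first edge of a forest path from c p to c q would be closed up by a cycle arc from c q back to c p.
  forest-separates-cycle-vertices : ∀ {x y m} → Walk Forest x y m → ∀ {p q} → x ≡ c p → y ≡ c q → p ≡ q
  forest-separates-cycle-vertices {x} {y} w {p} {q} x≡ y≡ with pathify w
  ... | path here _ , _ = inj C (trans (sym x≡) y≡)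
  ... | path (step e rest) (x∉rest , _) , _ =
    ⊥-elim (off-cycle-edge-is-bridge (proj₁ e) (proj₂ e)
      (map-walk-avoiding x forest-edge-avoiding rest x∉rest ++ map-walk (CycleGraph⊆deleteEdge (proj₂ e)) back))
    where
    back : Walk CycleGraph y x (δ q p)
    back = subst₂ (λ s t → Walk CycleGraph s t (δ q p)) (sym y≡) (sym x≡) (arc q p)

  cycleVertex? : ∀ x → Dec (∃ λ i → x ≡ c i)
  cycleVertex? x = any? (λ i → x Fin.≟ c i)

  CycEdge? : ∀ u v → Dec (CycEdge C u v)
  CycEdge? u v =
    any? (λ i → ((u Fin.≟ c i) ×-dec (v Fin.≟ c (next i))) ⊎-dec ((v Fin.≟ c i) ×-dec (u Fin.≟ c (next i))))

  CycEdge-start : ∀ {u v} → CycEdge C u v → ∃ λ i → u ≡ c i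
  CycEdge-start (i , inj₁ (u≡ , _)) = i , u≡
  CycEdge-start (i , inj₂ (_ , u≡)) = next i , u≡

  forest-reaches-cycle : ∀ {x y m} → Walk G x y m → ∀ {i} → y ≡ c i → ∃ λ r → Reachable Forest x (c r)
  forest-reaches-cycle {x} w y≡ with cycleVertex? x
  ... | yes (r , x≡) = r , 0 , subst (λ z → Walk Forest z (c r) 0) (sym x≡) here
  ... | no x∉C with w
  ...   | here      = ⊥-elim (x∉C (_ , y≡))
  ...   | step e w′ = Product.map₂ (Product.map suc (step (e , λ e∈C → x∉C (CycEdge-start e∈C))))
                                   (forest-reaches-cycle w′ y≡)

  anchor : ∀ x → Σ (Fin (len C)) λ r → Path Forest x (c r)
  anchor x = Product.map₂ (λ (_ , w) → proj₁ (pathify w))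
                          (forest-reaches-cycle (proj₂ (proj₁ unicyclic x (c Fin.zero))) refl)

  root : Fin n → Fin (len C)
  root x = proj₁ (anchor x)

  toRoot : ∀ x → Path Forest x (c (root x))
  toRoot x = proj₂ (anchor x)

  height : Fin n → ℕ
  height x = length (toRoot x)

  root-cycle : ∀ i → root (c i) ≡ i
  root-cycle i = sym (forest-separates-cycle-vertices (walk (toRoot (c i))) refl refl)

  height-cycle : ∀ i → height (c i) ≡ 0
  height-cycle i = path-loop-length (walk (toRoot (c i))) (isPath (toRoot (c i))) (cong c (sym (root-cycle i)))

  -- Forest paths with distinct first steps would put the first edge of one of them on a cycle.
  forest-path-shortest : ∀ {y z m m′} (p : Walk Forest y z m) → IsPath p →
                         (q : Walk Forest y z m′) → IsPath q → m ≤ m′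
  forest-path-shortest here       _         _ _ = z≤n
  forest-path-shortest (step _ p) (y∉p , _) here _ = ⊥-elim (y∉p (end-∈ᵥ p))
  forest-path-shortest {y} (step {v = v} e p) (y∉p , p-path) (step {v = w} e′ q) (y∉q , q-path) with v Fin.≟ w
  ... | yes refl = s≤s (forest-path-shortest p p-path q q-path)
  ... | no v≢w =
    ⊥-elim (off-cycle-edge-is-bridge (proj₁ e) (proj₂ e) ((avoid p y∉p ++ reverse (avoid q y∉q)) ++ step w-y here))
    where
    avoid : ∀ {s t k} (r : Walk Forest s t k) → ¬ y ∈ᵥ r → Walk (deleteEdge G y v) s t k
    avoid = map-walk-avoiding y forest-edge-avoiding
    w-y : Adj (deleteEdge G y v) w y
    w-y = Graph.sym G (proj₁ e′) , (λ (w≡y , _) → y∉q (subst (_∈ᵥ q) w≡y (start-∈ᵥ q)))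
                                 , (λ (w≡v , _) → v≢w (sym w≡v))

  forest-path-≤-walk : ∀ {y z m} (p : Path Forest y z) → Walk Forest y z m → length p ≤ m
  forest-path-≤-walk (path p p-path) w =
    let path q q-path , q≤w = pathify w in ≤-trans (forest-path-shortest p p-path q q-path) q≤w

  root-forest-edge : ∀ {y z} → Adj Forest y z → root y ≡ root z
  root-forest-edge {y} {z} e = forest-separates-cycle-vertices (reverse (walk (toRoot y)) ++ step e (walk (toRoot z))) refl refl

  height-forest-edge : ∀ {y z} → Adj Forest y z → height y ≤ suc (height z)
  height-forest-edge {y} {z} e = forest-path-≤-walk (toRoot y)
    (step e (subst (λ r → Walk Forest z (c r) (height z)) (sym (root-forest-edge e)) (walk (toRoot z))))

  viaRoot : Fin n → Fin (len C) → ℕ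
  viaRoot y s = height y + δ (root y) s

  viaRoot-cycle : ∀ i s → viaRoot (c i) s ≡ δ i s
  viaRoot-cycle i s = cong₂ _+_ (height-cycle i) (cong (λ r → δ r s) (root-cycle i))

  viaRoot-step : ∀ {y z} s → Adj G y z → viaRoot y s ≤ suc (viaRoot z s)
  viaRoot-step {y} {z} s y-z with CycEdge? y z
  ... | yes (i , inj₁ (refl , refl)) =
    subst₂ (λ p q → p ≤ suc q) (sym (viaRoot-cycle i s)) (sym (viaRoot-cycle (next i) s)) (δ≤1+δ-next 1<len i s)
  ... | yes (i , inj₂ (refl , refl)) =
    subst₂ (λ p q → p ≤ suc q) (sym (viaRoot-cycle (next i) s)) (sym (viaRoot-cycle i s)) (δ-next≤1+δ 1<len i s)
  ... | no y-z∉C =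
    +-mono-≤ (height-forest-edge (y-z , y-z∉C)) (≤-reflexive (cong (λ r → δ r s) (root-forest-edge (y-z , y-z∉C))))

  viaRoot-≤-walk : ∀ {y z m} → Walk G y z m → ∀ {s} → z ≡ c s → viaRoot y s ≤ m
  viaRoot-≤-walk here         {s} refl = ≤-reflexive (trans (viaRoot-cycle s s) (δ-refl s))
  viaRoot-≤-walk (step y-z w) {s} z≡  = ≤-trans (viaRoot-step s y-z) (s≤s (viaRoot-≤-walk w z≡))

  Dist-viaRoot : ∀ y s → Dist G y (c s) (viaRoot y s)
  Dist-viaRoot y s = map-walk proj₁ (walk (toRoot y)) ++ map-walk proj₁ (arc (root y) s) , λ _ w → viaRoot-≤-walk w refl

  Dist-cycle : ∀ a b → Dist G (c a) (c b) (δ a b)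
  Dist-cycle a b = subst (Dist G (c a) (c b)) (viaRoot-cycle a b) (Dist-viaRoot (c a) b)

  geodesic-δ : ∀ {i j l} → GeodesicTriple G C i j l → Geodesic i j l
  geodesic-δ {i} {j} {l} (_ , _ , _ , _ , _ , _ , d-ij , d-jl , d-il , sum) =
    trans (cong₂ _+_ (cong₂ _+_ (Dist-unique (Dist-cycle i j) d-ij) (Dist-unique (Dist-cycle j l) d-jl))
                     (Dist-unique (Dist-cycle i l) d-il))
          sum

  roots-differ : ∀ {x x′} → ¬ Reachable Forest x x′ → root x ≢ root x′
  roots-differ {x} {x′} x≁x′ same-root = x≁x′ (_ , walk (toRoot x) ++ reverse x′-to-root-x)
    where
    x′-to-root-x : Walk Forest x′ (c (root x)) (height x′)
    x′-to-root-x = subst (λ r → Walk Forest x′ (c r) (height x′)) (sym same-root) (walk (toRoot x′))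

  distinguishes : ∀ {x x′} s → viaRoot x s ≢ viaRoot x′ s → Distinguishes G (c s) x x′
  distinguishes s ne (_ , d-x , d-x′) = ne (trans (Dist-unique (Dist-viaRoot _ s) d-x) (Dist-unique d-x′ (Dist-viaRoot _ s)))

lemma4 : ∀ {n : ℕ} (G : Graph n) (C : Cycle G) → Unicyclic G C →
           (i j l : Fin (len C)) → GeodesicTriple G C i j l →
           (x x' : Fin n) → ¬ Reachable (deleteCycleEdges G C) x x' →
           ∃ λ s → (s ≡ vert C i ⊎ s ≡ vert C j ⊎ s ≡ vert C l) × Distinguishes G s x x'
lemma4 G C unicyclic i j l triple@(i≢j , j≢l , i≢l , _) x x′ x≁x′ = resolve
  where
  open UnicyclicGraph G C unicyclic
  resolve : ∃ λ s → (s ≡ c i ⊎ s ≡ c j ⊎ s ≡ c l) × Distinguishes G s x x′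
  resolve with viaRoot x i ≟ viaRoot x′ i | viaRoot x j ≟ viaRoot x′ j | viaRoot x l ≟ viaRoot x′ l
  ... | no ne | _     | _     = c i , inj₁ refl , distinguishes i ne
  ... | yes _ | no ne | _     = c j , inj₂ (inj₁ refl) , distinguishes j ne
  ... | yes _ | yes _ | no ne = c l , inj₂ (inj₂ refl) , distinguishes l ne
  ... | yes e-i | yes e-j | yes e-l =
    ⊥-elim (geodesic-resolves i≢j j≢l i≢l (geodesic-δ triple) (roots-differ x≁x′) e-i e-j e-l)
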